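{- Let $t$ be a combinator and $\sigma$ a (type-respecting) substitution such that all variables in the domain of $\sigma$ have the same simple type. If $t\in HN$ and every combinator in the image of $\sigma$ is in $HN$, then $\sigma(t)\in HN$.
   Context: Combinators: $C ::= x \mid K \mid S \mid I \mid (C\ C)$ with $x$ ranging over variables; application associates to the left. Simple types are built from base types with $\to$. Each variable carries a simple type; typing: $I:A\to A$, $K:A\to B\to A$, $S:(A\to B\to C)\to(A\to B)\to A\to C$ for all types $A,B,C$, and if $u:A\to B$, $v:A$ then $(u\ v):B$. A substitution $\sigma$ is type-respecting if $\sigma(y)$ is a typed combinator of the type of $y$ for every $y$ in its domain. The set $HN$ of highly normalizing combinators is the smallest set such that: (1) $S,K,I\in HN$, and $(x\ t_1\ \cdots\ t_n)\in HN$ for any variable $x$ and $t_1,\dots,t_n\in HN$ ($n\ge0$); (2) $(K\ t_1)\in HN$ and $(S\ t_1)\in HN$ if $t_1\in HN$; (3) $(S\ t_1\ t_2)\in HN$ if $(t_1\ x\ (t_2\ x))\in HN$ for a fresh variable $x$; (4) $(I\ t_1\ \cdots\ t_n)\in HN$ for $n\ge1$ if $(t_1\ t_2\ \cdots\ t_n)\in HN$; (5) $(K\ t_1\ \cdots\ t_n)\in HN$ for $n\ge2$ if $(t_1\ t_3\ \cdots\ t_n)\in HN$ and $t_2\in HN$; (6) $(S\ t_1\ \cdots\ t_n)\in HN$ for $n\ge3$ if $(t_1\ t_3\ (t_2\ t_3)\ t_4\ \cdots\ t_n)\in HN$. -}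

module Defs where

open import Data.Nat using (ℕ)
open import Data.Product using (_×_; _,_; proj₂; ∃)
open import Data.List using (List; []; _∷_)
open import Data.List.Relation.Unary.All using (All)
open import Data.Maybe using (Maybe; just; nothing)
open import Relation.Binary.PropositionalEquality using (_≡_)
open import Relation.Nullary using (¬_)

data Ty : Set where
  base : ℕ → Ty
  _⇒_  : Ty → Ty → Ty
infixr 5 _⇒_

Var : Set
Var = ℕ × Ty

tyOf : Var → Ty
tyOf = proj₂

data Comb : Set where
  var : Var → Comb
  S K I : Comb
  _·_ : Comb → Comb → Comb
infixl 9 _·_

_·*_ : Comb → List Comb → Comb
t ·* []       = t
t ·* (u ∷ us) = (t · u) ·* us
infixl 8 _·*_

data _∶_ : Comb → Ty → Set where
  tvar : (x : Var) → var x ∶ tyOf x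
  tI : ∀ {A} → I ∶ (A ⇒ A)
  tK : ∀ {A B} → K ∶ (A ⇒ B ⇒ A)
  tS : ∀ {A B C} → S ∶ ((A ⇒ B ⇒ C) ⇒ (A ⇒ B) ⇒ A ⇒ C)
  tapp : ∀ {A B u v} → u ∶ (A ⇒ B) → v ∶ A → (u · v) ∶ B

Typed : Comb → Set
Typed t = ∃ λ A → t ∶ A

data _occursIn_ (x : Var) : Comb → Set where
  here : x occursIn var x
  left  : ∀ {u v} → x occursIn u → x occursIn (u · v)
  right : ∀ {u v} → x occursIn v → x occursIn (u · v)

data HN : Comb → Set where
  hS : HN S
  hK : HN K
  hI : HN I
  hvar : (x : Var) (ts : List Comb) → All HN ts → HN (var x ·* ts)
  hK1 : ∀ {t₁} → HN t₁ → HN (K · t₁)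
  hS1 : ∀ {t₁} → HN t₁ → HN (S · t₁)
  hS2 : ∀ {t₁ t₂} (x : Var) → ¬ (x occursIn t₁) → ¬ (x occursIn t₂) →
        HN (t₁ · var x · (t₂ · var x)) → HN (S · t₁ · t₂)
  hIapp : ∀ {t₁} (ts : List Comb) → HN (t₁ ·* ts) → HN (I · t₁ ·* ts)
  hKapp : ∀ {t₁ t₂} (ts : List Comb) → HN (t₁ ·* ts) → HN t₂ →
          HN (K · t₁ · t₂ ·* ts)
  hSapp : ∀ {t₁ t₂ t₃} (ts : List Comb) →
          HN (t₁ · t₃ · (t₂ · t₃) ·* ts) → HN (S · t₁ · t₂ · t₃ ·* ts)

Subst : Set
Subst = Var → Maybe Comb

lookupσ : Subst → Var → Comb
lookupσ σ y with σ y
... | just u  = u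
... | nothing = var y

sub : Subst → Comb → Comb
sub σ (var y) = lookupσ σ y
sub σ S = S
sub σ K = K
sub σ I = I
sub σ (u · v) = sub σ u · sub σ v

TypeRespecting : Subst → Set
TypeRespecting σ = ∀ y u → σ y ≡ just u → u ∶ tyOf y

DomainOfType : Subst → Ty → Set
DomainOfType σ A = ∀ y u → σ y ≡ just u → tyOf y ≡ A

ImageHN : Subst → Set
ImageHN σ = ∀ y u → σ y ≡ just u → HN u

-- Induction on the type A, inside which induction on the HN derivation of t.  The only
-- interesting case is a variable head x with σ(x) = u : A, where we must show that
-- u s₁ ⋯ sₙ ∈ HN for HN arguments sᵢ.  For a fresh variable w : A₁ (A = A₁ → A₂) the
-- combinator u w is in HN, because HN is closed under substituting and appending neutral
-- terms x t₁ ⋯ tₖ; substituting s₁ for w is then an instance of the lemma at the smaller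
-- type A₁, and so on along the spine.  In rule (3) the fresh variable of the premise may
-- have any type, so the induction is stated for typing in an arbitrary context and for
-- substitutions that may also rename variables.
module Submission where

open import Defs
open import Data.Nat using (ℕ; suc; _≤_; _⊔_)
open import Data.Nat.Properties using (m≤m⊔n; m≤n⊔m; ≤-trans; ≤-refl; 1+n≰n)
  renaming (_≟_ to _≟ℕ_)
open import Data.Product using (_×_; _,_; ∃; ∃₂)
open import Data.Product.Properties using (≡-dec)
open import Data.Sum using (_⊎_; inj₁; inj₂)
open import Data.List using (List; []; _∷_; _++_; map)
open import Data.List.Relation.Unary.All using (All; []; _∷_)
import Data.List.Relation.Unary.All as All
open import Data.List.Relation.Unary.All.Properties using (++⁺)
open import Data.Maybe using (just; nothing)
open import Function using (_∘_)
open import Relation.Binary.PropositionalEquality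
open import Relation.Nullary using (¬_; yes; no; contradiction)
open import Relation.Binary.Definitions using (DecidableEquality)

infix 4 _≟ᵀ_ _≟_

_≟ᵀ_ : DecidableEquality Ty
base m ≟ᵀ base n with m ≟ℕ n
... | yes refl = yes refl
... | no m≢n   = no λ { refl → m≢n refl }
base _ ≟ᵀ (_ ⇒ _) = no λ ()
(_ ⇒ _) ≟ᵀ base _ = no λ ()
(A ⇒ B) ≟ᵀ (C ⇒ D) with A ≟ᵀ C | B ≟ᵀ D
... | yes refl | yes refl = yes refl
... | no A≢C   | _        = no λ { refl → A≢C refl }
... | _        | no B≢D   = no λ { refl → B≢D refl }

_≟_ : DecidableEquality Var
_≟_ = ≡-dec _≟ℕ_ _≟ᵀ_

_[_≔_] : {X : Set} → (Var → X) → Var → X → Var → X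
(f [ x ≔ c ]) y with y ≟ x
... | yes _ = c
... | no  _ = f y

update-same : {X : Set} (f : Var → X) (x : Var) (c : X) → (f [ x ≔ c ]) x ≡ c
update-same f x c with x ≟ x
... | yes _  = refl
... | no x≢x = contradiction refl x≢x

update-other : {X : Set} (f : Var → X) {x : Var} (c : X) {y : Var} → y ≢ x → (f [ x ≔ c ]) y ≡ f y
update-other f {x} c {y} y≢x with y ≟ x
... | yes y≡x = contradiction y≡x y≢x
... | no  _   = refl

infixl 10 _⟪_⟫

_⟪_⟫ : Comb → (Var → Comb) → Comb
var y   ⟪ ρ ⟫ = ρ y
S       ⟪ ρ ⟫ = S
K       ⟪ ρ ⟫ = K
I       ⟪ ρ ⟫ = I
(u · v) ⟪ ρ ⟫ = u ⟪ ρ ⟫ · v ⟪ ρ ⟫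

⟪⟫-cong : ∀ {ρ ρ′} t → (∀ v → v occursIn t → ρ v ≡ ρ′ v) → t ⟪ ρ ⟫ ≡ t ⟪ ρ′ ⟫
⟪⟫-cong (var y) eq = eq y here
⟪⟫-cong S       eq = refl
⟪⟫-cong K       eq = refl
⟪⟫-cong I       eq = refl
⟪⟫-cong (u · v) eq = cong₂ _·_ (⟪⟫-cong u (λ w → eq w ∘ left)) (⟪⟫-cong v (λ w → eq w ∘ right))

⟪⟫-update-∉ : ∀ ρ {x : Var} (c : Comb) t → ¬ x occursIn t → t ⟪ ρ [ x ≔ c ] ⟫ ≡ t ⟪ ρ ⟫
⟪⟫-update-∉ ρ c t x∉t = ⟪⟫-cong t λ v v∈t → update-other ρ c λ { refl → x∉t v∈t }

⟪var⟫ : ∀ t → t ⟪ var ⟫ ≡ t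
⟪var⟫ (var y) = refl
⟪var⟫ S       = refl
⟪var⟫ K       = refl
⟪var⟫ I       = refl
⟪var⟫ (u · v) = cong₂ _·_ (⟪var⟫ u) (⟪var⟫ v)

·*-++ : ∀ h xs ys → h ·* (xs ++ ys) ≡ h ·* xs ·* ys
·*-++ h []       ys = refl
·*-++ h (x ∷ xs) ys = ·*-++ (h · x) xs ys

⟪⟫-·* : ∀ ρ h ts → (h ·* ts) ⟪ ρ ⟫ ≡ h ⟪ ρ ⟫ ·* map _⟪ ρ ⟫ ts
⟪⟫-·* ρ h []       = refl
⟪⟫-·* ρ h (t ∷ ts) = ⟪⟫-·* ρ (h · t) ts

⟪⟫-·*-++ : ∀ ρ h ts args → (h ·* ts) ⟪ ρ ⟫ ·* args ≡ h ⟪ ρ ⟫ ·* (map _⟪ ρ ⟫ ts ++ args)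
⟪⟫-·*-++ ρ h ts args =
  trans (cong (_·* args) (⟪⟫-·* ρ h ts)) (sym (·*-++ (h ⟪ ρ ⟫) (map _⟪ ρ ⟫ ts) args))

⟪⟫-S-premise : ∀ ρ {x t₁ t₂} (c : Comb) → ¬ x occursIn t₁ → ¬ x occursIn t₂ →
               (t₁ · var x · (t₂ · var x)) ⟪ ρ [ x ≔ c ] ⟫ ≡ t₁ ⟪ ρ ⟫ · c · (t₂ ⟪ ρ ⟫ · c)
⟪⟫-S-premise ρ {x} {t₁} {t₂} c x∉t₁ x∉t₂ =
  cong₂ _·_ (cong₂ _·_ (⟪⟫-update-∉ ρ c t₁ x∉t₁) (update-same ρ x c))
            (cong₂ _·_ (⟪⟫-update-∉ ρ c t₂ x∉t₂) (update-same ρ x c))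

sub-⟪lookupσ⟫ : ∀ σ t → sub σ t ≡ t ⟪ lookupσ σ ⟫
sub-⟪lookupσ⟫ σ (var y) = refl
sub-⟪lookupσ⟫ σ S       = refl
sub-⟪lookupσ⟫ σ K       = refl
sub-⟪lookupσ⟫ σ I       = refl
sub-⟪lookupσ⟫ σ (u · v) = cong₂ _·_ (sub-⟪lookupσ⟫ σ u) (sub-⟪lookupσ⟫ σ v)

maxName : Comb → ℕ
maxName (var (n , _)) = n
maxName S             = 0
maxName K             = 0
maxName I             = 0
maxName (u · v)       = maxName u ⊔ maxName v

occursIn⇒≤maxName : ∀ {n A t} → (n , A) occursIn t → n ≤ maxName t
occursIn⇒≤maxName here = ≤-refl
occursIn⇒≤maxName {t = u · v} (left o) =
  ≤-trans (occursIn⇒≤maxName o) (m≤m⊔n (maxName u) (maxName v))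
occursIn⇒≤maxName {t = u · v} (right o) =
  ≤-trans (occursIn⇒≤maxName o) (m≤n⊔m (maxName u) (maxName v))

fresh : Comb → Ty → Var
fresh t A = suc (maxName t) , A

fresh-∉ : ∀ t A → ¬ fresh t A occursIn t
fresh-∉ t A = 1+n≰n ∘ occursIn⇒≤maxName

fresh-∉ˡ : ∀ u v A → ¬ fresh (u · v) A occursIn u
fresh-∉ˡ u v A = fresh-∉ (u · v) A ∘ left

fresh-∉ʳ : ∀ u v A → ¬ fresh (u · v) A occursIn v
fresh-∉ʳ u v A = fresh-∉ (u · v) A ∘ right

-- Neutral combinators (HN does not look at types, so fresh variables below get an arbitrary type)

Neutral : Comb → Set
Neutral u = ∃₂ λ x ns → u ≡ var x ·* ns × All HN ns

neutral-HN : ∀ {u} → Neutral u → HN u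
neutral-HN (x , ns , refl , hs) = hvar x ns hs

neutral-·* : ∀ {u} xs → Neutral u → All HN xs → Neutral (u ·* xs)
neutral-·* xs (x , ns , refl , hs) hxs = x , ns ++ xs , sym (·*-++ (var x) ns xs) , ++⁺ hs hxs

neutral-· : ∀ {u s} → Neutral u → HN s → Neutral (u · s)
neutral-· n h = neutral-·* (_ ∷ []) n (h ∷ [])

var-neutral : ∀ x → Neutral (var x)
var-neutral x = x , [] , refl , []

S·*-HN : ∀ {args} → All Neutral args → HN (S ·* args)
S·*-HN []                = hS
S·*-HN (p ∷ [])          = hS1 (neutral-HN p)
S·*-HN {a ∷ b ∷ []} (p ∷ q ∷ []) =
  hS2 z (fresh-∉ˡ a b _) (fresh-∉ʳ a b _)
    (neutral-HN (neutral-· (neutral-· p (hvar z [] [])) (neutral-HN (neutral-· q (hvar z [] [])))))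
  where z = fresh (a · b) (base 0)
S·*-HN {_ ∷ _ ∷ _ ∷ rest} (p ∷ q ∷ r ∷ ps) =
  hSapp rest (neutral-HN (neutral-·* rest acbc (All.map neutral-HN ps)))
  where acbc = neutral-· (neutral-· p (neutral-HN r)) (neutral-HN (neutral-· q (neutral-HN r)))

K·*-HN : ∀ {args} → All Neutral args → HN (K ·* args)
K·*-HN []       = hK
K·*-HN (p ∷ []) = hK1 (neutral-HN p)
K·*-HN {_ ∷ _ ∷ rest} (p ∷ q ∷ ps) =
  hKapp rest (neutral-HN (neutral-·* rest p (All.map neutral-HN ps))) (neutral-HN q)

I·*-HN : ∀ {args} → All Neutral args → HN (I ·* args)
I·*-HN []       = hI
I·*-HN {_ ∷ rest} (p ∷ ps) = hIapp rest (neutral-HN (neutral-·* rest p (All.map neutral-HN ps)))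

NeutralSubst : (Var → Comb) → Set
NeutralSubst ρ = ∀ y → Neutral (ρ y)

update-neutral : ∀ {ρ u} x → NeutralSubst ρ → Neutral u → NeutralSubst (ρ [ x ≔ u ])
update-neutral x nρ nu y with y ≟ x
... | yes _ = nu
... | no  _ = nρ y

mutual
  ⟪neutral⟫·*-HN : ∀ {t} → HN t → ∀ {ρ} → NeutralSubst ρ →
                   ∀ {args} → All Neutral args → HN (t ⟪ ρ ⟫ ·* args)
  ⟪neutral⟫·*-HN hS nρ na = S·*-HN na
  ⟪neutral⟫·*-HN hK nρ na = K·*-HN na
  ⟪neutral⟫·*-HN hI nρ na = I·*-HN na
  ⟪neutral⟫·*-HN (hvar x ts hs) {ρ} nρ {args} na =
    subst HN (sym (⟪⟫-·*-++ ρ (var x) ts args))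
      (neutral-HN (neutral-·* _ (nρ x) (++⁺ (⟪neutral⟫-HN* hs nρ) (All.map neutral-HN na))))
  ⟪neutral⟫·*-HN (hK1 d) nρ []       = hK1 (⟪neutral⟫·*-HN d nρ [])
  ⟪neutral⟫·*-HN (hK1 d) nρ {_ ∷ rest} (p ∷ ps) = hKapp rest (⟪neutral⟫·*-HN d nρ ps) (neutral-HN p)
  ⟪neutral⟫·*-HN (hS1 d) nρ []       = hS1 (⟪neutral⟫·*-HN d nρ [])
  ⟪neutral⟫·*-HN (hS1 {t₁} d) {ρ} nρ {a ∷ []} (p ∷ []) =
    hS2 z (fresh-∉ˡ (t₁ ⟪ ρ ⟫) a _) (fresh-∉ʳ (t₁ ⟪ ρ ⟫) a _)
      (⟪neutral⟫·*-HN d nρ (var-neutral z ∷ neutral-· p (hvar z [] []) ∷ []))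
    where z = fresh (t₁ ⟪ ρ ⟫ · a) (base 0)
  ⟪neutral⟫·*-HN (hS1 d) nρ {_ ∷ _ ∷ rest} (p ∷ q ∷ ps) =
    hSapp rest (⟪neutral⟫·*-HN d nρ (q ∷ neutral-· p (neutral-HN q) ∷ ps))
  ⟪neutral⟫·*-HN (hS2 {t₁} {t₂} x x∉t₁ x∉t₂ d) {ρ} nρ [] =
    hS2 z (fresh-∉ˡ (t₁ ⟪ ρ ⟫) (t₂ ⟪ ρ ⟫) _) (fresh-∉ʳ (t₁ ⟪ ρ ⟫) (t₂ ⟪ ρ ⟫) _)
      (subst HN (⟪⟫-S-premise ρ (var z) x∉t₁ x∉t₂)
        (⟪neutral⟫·*-HN d (update-neutral x nρ (var-neutral z)) []))
    where z = fresh (t₁ ⟪ ρ ⟫ · t₂ ⟪ ρ ⟫) (base 0)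
  ⟪neutral⟫·*-HN (hS2 x x∉t₁ x∉t₂ d) {ρ} nρ {a ∷ rest} (p ∷ ps) =
    hSapp rest (subst HN (cong (_·* rest) (⟪⟫-S-premise ρ a x∉t₁ x∉t₂))
      (⟪neutral⟫·*-HN d (update-neutral x nρ p) ps))
  ⟪neutral⟫·*-HN (hIapp {t₁} ts d) {ρ} nρ {args} na =
    subst HN (sym (⟪⟫-·*-++ ρ (I · t₁) ts args))
      (hIapp (map _⟪ ρ ⟫ ts ++ args) (subst HN (⟪⟫-·*-++ ρ t₁ ts args) (⟪neutral⟫·*-HN d nρ na)))
  ⟪neutral⟫·*-HN (hKapp {t₁} {t₂} ts d d₂) {ρ} nρ {args} na =
    subst HN (sym (⟪⟫-·*-++ ρ (K · t₁ · t₂) ts args))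
      (hKapp (map _⟪ ρ ⟫ ts ++ args) (subst HN (⟪⟫-·*-++ ρ t₁ ts args) (⟪neutral⟫·*-HN d nρ na))
                                     (⟪neutral⟫·*-HN d₂ nρ []))
  ⟪neutral⟫·*-HN (hSapp {t₁} {t₂} {t₃} ts d) {ρ} nρ {args} na =
    subst HN (sym (⟪⟫-·*-++ ρ (S · t₁ · t₂ · t₃) ts args))
      (hSapp (map _⟪ ρ ⟫ ts ++ args)
        (subst HN (⟪⟫-·*-++ ρ (t₁ · t₃ · (t₂ · t₃)) ts args) (⟪neutral⟫·*-HN d nρ na)))

  ⟪neutral⟫-HN* : ∀ {ts} → All HN ts → ∀ {ρ} → NeutralSubst ρ → All HN (map _⟪ ρ ⟫ ts)
  ⟪neutral⟫-HN* []       nρ = []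
  ⟪neutral⟫-HN* (h ∷ hs) nρ = ⟪neutral⟫·*-HN h nρ [] ∷ ⟪neutral⟫-HN* hs nρ

HN-·var : ∀ {u} → HN u → ∀ w → HN (u · var w)
HN-·var {u} d w =
  subst HN (cong (_· var w) (⟪var⟫ u)) (⟪neutral⟫·*-HN d var-neutral (var-neutral w ∷ []))

Context : Set
Context = Var → Ty

infix 4 _⊢_∶_

data _⊢_∶_ (Γ : Context) : Comb → Ty → Set where
  ⊢var : ∀ x → Γ ⊢ var x ∶ Γ x
  ⊢I : ∀ {A} → Γ ⊢ I ∶ A ⇒ A
  ⊢K : ∀ {A B} → Γ ⊢ K ∶ A ⇒ B ⇒ A
  ⊢S : ∀ {A B C} → Γ ⊢ S ∶ (A ⇒ B ⇒ C) ⇒ (A ⇒ B) ⇒ A ⇒ C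
  ⊢· : ∀ {A B u v} → Γ ⊢ u ∶ A ⇒ B → Γ ⊢ v ∶ A → Γ ⊢ u · v ∶ B

∶⇒⊢ : ∀ {t T} → t ∶ T → tyOf ⊢ t ∶ T
∶⇒⊢ (tvar x)   = ⊢var x
∶⇒⊢ tI         = ⊢I
∶⇒⊢ tK         = ⊢K
∶⇒⊢ tS         = ⊢S
∶⇒⊢ (tapp u v) = ⊢· (∶⇒⊢ u) (∶⇒⊢ v)

⊢-cong : ∀ {Γ Δ t T} → (∀ v → v occursIn t → Γ v ≡ Δ v) → Γ ⊢ t ∶ T → Δ ⊢ t ∶ T
⊢-cong eq (⊢var x)   = subst (_ ⊢ var x ∶_) (sym (eq x here)) (⊢var x)
⊢-cong eq ⊢I         = ⊢I
⊢-cong eq ⊢K         = ⊢K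
⊢-cong eq ⊢S         = ⊢S
⊢-cong eq (⊢· ⊢u ⊢v) = ⊢· (⊢-cong (λ w → eq w ∘ left) ⊢u) (⊢-cong (λ w → eq w ∘ right) ⊢v)

⊢-update-∉ : ∀ {Γ x t T} B → ¬ x occursIn t → Γ ⊢ t ∶ T → Γ [ x ≔ B ] ⊢ t ∶ T
⊢-update-∉ {Γ} B x∉t = ⊢-cong λ v v∈t → sym (update-other Γ B λ { refl → x∉t v∈t })

WellTyped : Context → (Var → Comb) → Set
WellTyped Γ ρ = ∀ y → tyOf ⊢ ρ y ∶ Γ y

⊢-⟪⟫ : ∀ {Γ ρ t T} → WellTyped Γ ρ → Γ ⊢ t ∶ T → tyOf ⊢ t ⟪ ρ ⟫ ∶ T
⊢-⟪⟫ ⊢ρ (⊢var x)   = ⊢ρ x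
⊢-⟪⟫ ⊢ρ ⊢I         = ⊢I
⊢-⟪⟫ ⊢ρ ⊢K         = ⊢K
⊢-⟪⟫ ⊢ρ ⊢S         = ⊢S
⊢-⟪⟫ ⊢ρ (⊢· ⊢u ⊢v) = ⊢· (⊢-⟪⟫ ⊢ρ ⊢u) (⊢-⟪⟫ ⊢ρ ⊢v)

data Spine (Γ : Context) : Ty → List Comb → Set where
  []  : ∀ {A} → Spine Γ A []
  _∷_ : ∀ {A B s ss} → Γ ⊢ s ∶ A → Spine Γ B ss → Spine Γ (A ⇒ B) (s ∷ ss)

⊢·*-inv : ∀ {Γ h} ts {T} → Γ ⊢ h ·* ts ∶ T → ∃ λ H → Γ ⊢ h ∶ H × Spine Γ H ts
⊢·*-inv []       ⊢t = _ , ⊢t , []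
⊢·*-inv (s ∷ ts) ⊢t with ⊢·*-inv ts ⊢t
... | H , ⊢· ⊢h ⊢s , ⊢ts = _ , ⊢h , ⊢s ∷ ⊢ts

⊢·*-head : ∀ {Γ h h′} ts {T} → (∀ {H} → Γ ⊢ h ∶ H → Γ ⊢ h′ ∶ H) → Γ ⊢ h ·* ts ∶ T → Γ ⊢ h′ ·* ts ∶ T
⊢·*-head []       f ⊢t = f ⊢t
⊢·*-head (s ∷ ts) f ⊢t = ⊢·*-head ts (λ { (⊢· ⊢h ⊢s) → ⊢· (f ⊢h) ⊢s }) ⊢t

⊢I-redex : ∀ {Γ t T} → Γ ⊢ I · t ∶ T → Γ ⊢ t ∶ T
⊢I-redex (⊢· ⊢I ⊢t) = ⊢t

⊢K-redex : ∀ {Γ t₁ t₂ T} → Γ ⊢ K · t₁ · t₂ ∶ T → Γ ⊢ t₁ ∶ T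
⊢K-redex (⊢· (⊢· ⊢K ⊢t₁) _) = ⊢t₁

⊢S-redex : ∀ {Γ t₁ t₂ t₃ T} → Γ ⊢ S · t₁ · t₂ · t₃ ∶ T → Γ ⊢ t₁ · t₃ · (t₂ · t₃) ∶ T
⊢S-redex (⊢· (⊢· (⊢· ⊢S ⊢t₁) ⊢t₂) ⊢t₃) = ⊢· (⊢· ⊢t₁ ⊢t₃) (⊢· ⊢t₂ ⊢t₃)

Spine-⟪⟫ : ∀ {Γ ρ H ts} → WellTyped Γ ρ → Spine Γ H ts → Spine tyOf H (map _⟪ ρ ⟫ ts)
Spine-⟪⟫ ⊢ρ []          = []
Spine-⟪⟫ ⊢ρ (⊢s ∷ ⊢ss) = ⊢-⟪⟫ ⊢ρ ⊢s ∷ Spine-⟪⟫ ⊢ρ ⊢ss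

IsVar : Comb → Set
IsVar u = ∃ λ w → u ≡ var w

RenamesOrHNAt : Ty → Context → (Var → Comb) → Set
RenamesOrHNAt A Γ ρ = ∀ y → IsVar (ρ y) ⊎ (Γ y ≡ A × HN (ρ y))

mutual
  ⟪⟫-HN : ∀ A {Γ t T} → HN t → Γ ⊢ t ∶ T →
          ∀ {ρ} → WellTyped Γ ρ → RenamesOrHNAt A Γ ρ → HN (t ⟪ ρ ⟫)
  ⟪⟫-HN A hS ⊢t ⊢ρ hρ = hS
  ⟪⟫-HN A hK ⊢t ⊢ρ hρ = hK
  ⟪⟫-HN A hI ⊢t ⊢ρ hρ = hI
  ⟪⟫-HN A (hvar x ts hs) ⊢t {ρ} ⊢ρ hρ with ⊢·*-inv ts ⊢t | hρ x
  ... | _ , ⊢var _ , ⊢ts | inj₁ (w , ρx≡w) =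
    subst HN (sym (trans (⟪⟫-·* ρ (var x) ts) (cong (_·* map _⟪ ρ ⟫ ts) ρx≡w)))
      (hvar w (map _⟪ ρ ⟫ ts) (⟪⟫-HN* A hs ⊢ts ⊢ρ hρ))
  ... | _ , ⊢var _ , ⊢ts | inj₂ (Γx≡A , hρx) =
    subst HN (sym (⟪⟫-·* ρ (var x) ts))
      (·*-HN A (subst (_ ⊢ ρ x ∶_) Γx≡A (⊢ρ x)) hρx
        (subst (λ H → Spine tyOf H _) Γx≡A (Spine-⟪⟫ ⊢ρ ⊢ts)) (⟪⟫-HN* A hs ⊢ts ⊢ρ hρ))
  ⟪⟫-HN A (hK1 d) (⊢· ⊢K ⊢t₁) ⊢ρ hρ = hK1 (⟪⟫-HN A d ⊢t₁ ⊢ρ hρ)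
  ⟪⟫-HN A (hS1 d) (⊢· ⊢S ⊢t₁) ⊢ρ hρ = hS1 (⟪⟫-HN A d ⊢t₁ ⊢ρ hρ)
  ⟪⟫-HN A {Γ} (hS2 {t₁} {t₂} x x∉t₁ x∉t₂ d) (⊢· (⊢· (⊢S {A₁} {B} {C}) ⊢t₁) ⊢t₂) {ρ} ⊢ρ hρ =
    hS2 z (fresh-∉ˡ (t₁ ⟪ ρ ⟫) (t₂ ⟪ ρ ⟫) A₁) (fresh-∉ʳ (t₁ ⟪ ρ ⟫) (t₂ ⟪ ρ ⟫) A₁)
      (subst HN (⟪⟫-S-premise ρ (var z) x∉t₁ x∉t₂) (⟪⟫-HN A d ⊢premise ⊢ρ′ hρ′))
    where
      z : Var
      z = fresh (t₁ ⟪ ρ ⟫ · t₂ ⟪ ρ ⟫) A₁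
      ⊢x : Γ [ x ≔ A₁ ] ⊢ var x ∶ A₁
      ⊢x = subst (Γ [ x ≔ A₁ ] ⊢ var x ∶_) (update-same Γ x A₁) (⊢var {Γ [ x ≔ A₁ ]} x)
      ⊢premise : Γ [ x ≔ A₁ ] ⊢ t₁ · var x · (t₂ · var x) ∶ C
      ⊢premise = ⊢· (⊢· (⊢-update-∉ A₁ x∉t₁ ⊢t₁) ⊢x) (⊢· (⊢-update-∉ A₁ x∉t₂ ⊢t₂) ⊢x)
      ⊢ρ′ : WellTyped (Γ [ x ≔ A₁ ]) (ρ [ x ≔ var z ])
      ⊢ρ′ y with y ≟ x
      ... | yes _ = ⊢var z
      ... | no  _ = ⊢ρ y
      hρ′ : RenamesOrHNAt A (Γ [ x ≔ A₁ ]) (ρ [ x ≔ var z ])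
      hρ′ y with y ≟ x
      ... | yes _ = inj₁ (z , refl)
      ... | no  _ = hρ y
  ⟪⟫-HN A (hIapp {t₁} ts d) ⊢t {ρ} ⊢ρ hρ =
    subst HN (sym (⟪⟫-·* ρ (I · t₁) ts))
      (hIapp (map _⟪ ρ ⟫ ts) (subst HN (⟪⟫-·* ρ t₁ ts)
        (⟪⟫-HN A d (⊢·*-head ts ⊢I-redex ⊢t) ⊢ρ hρ)))
  ⟪⟫-HN A (hKapp {t₁} {t₂} ts d d₂) ⊢t {ρ} ⊢ρ hρ with ⊢·*-inv ts ⊢t
  ... | _ , ⊢· _ ⊢t₂ , _ =
    subst HN (sym (⟪⟫-·* ρ (K · t₁ · t₂) ts))
      (hKapp (map _⟪ ρ ⟫ ts)
        (subst HN (⟪⟫-·* ρ t₁ ts) (⟪⟫-HN A d (⊢·*-head ts ⊢K-redex ⊢t) ⊢ρ hρ))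
        (⟪⟫-HN A d₂ ⊢t₂ ⊢ρ hρ))
  ⟪⟫-HN A (hSapp {t₁} {t₂} {t₃} ts d) ⊢t {ρ} ⊢ρ hρ =
    subst HN (sym (⟪⟫-·* ρ (S · t₁ · t₂ · t₃) ts))
      (hSapp (map _⟪ ρ ⟫ ts) (subst HN (⟪⟫-·* ρ (t₁ · t₃ · (t₂ · t₃)) ts)
        (⟪⟫-HN A d (⊢·*-head ts ⊢S-redex ⊢t) ⊢ρ hρ)))

  ⟪⟫-HN* : ∀ A {Γ H ts} → All HN ts → Spine Γ H ts →
           ∀ {ρ} → WellTyped Γ ρ → RenamesOrHNAt A Γ ρ → All HN (map _⟪ ρ ⟫ ts)
  ⟪⟫-HN* A []       []          ⊢ρ hρ = []
  ⟪⟫-HN* A (h ∷ hs) (⊢s ∷ ⊢ss) ⊢ρ hρ = ⟪⟫-HN A h ⊢s ⊢ρ hρ ∷ ⟪⟫-HN* A hs ⊢ss ⊢ρ hρ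

  ·*-HN : ∀ A {u ss} → tyOf ⊢ u ∶ A → HN u → Spine tyOf A ss → All HN ss → HN (u ·* ss)
  ·*-HN A ⊢u hu [] [] = hu
  ·*-HN (A₁ ⇒ A₂) {u} ⊢u hu (_∷_ {s = s} ⊢s ⊢ss) (hs ∷ hss) =
    ·*-HN A₂ (⊢· ⊢u ⊢s) (subst HN u·w⟪w≔s⟫ hu·w⟪w≔s⟫) ⊢ss hss
    where
      w : Var
      w = fresh u A₁
      u·w⟪w≔s⟫ : (u · var w) ⟪ var [ w ≔ s ] ⟫ ≡ u · s
      u·w⟪w≔s⟫ =
        cong₂ _·_ (trans (⟪⟫-update-∉ var s u (fresh-∉ u A₁)) (⟪var⟫ u)) (update-same var w s)
      ⊢w≔s : WellTyped tyOf (var [ w ≔ s ])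
      ⊢w≔s y with y ≟ w
      ... | yes refl = ⊢s
      ... | no  _    = ⊢var y
      hw≔s : RenamesOrHNAt A₁ tyOf (var [ w ≔ s ])
      hw≔s y with y ≟ w
      ... | yes refl = inj₂ (refl , hs)
      ... | no  _    = inj₁ (y , refl)
      hu·w⟪w≔s⟫ : HN ((u · var w) ⟪ var [ w ≔ s ] ⟫)
      hu·w⟪w≔s⟫ = ⟪⟫-HN A₁ (HN-·var hu w) (⊢· ⊢u (⊢var w)) ⊢w≔s hw≔s

lemma25 : (t : Comb) (σ : Subst) (A : Ty) →
          Typed t → TypeRespecting σ → DomainOfType σ A →
          HN t → ImageHN σ → HN (sub σ t)
lemma25 t σ A (_ , ⊢t) respects domain hn image =
  subst HN (sym (sub-⟪lookupσ⟫ σ t)) (⟪⟫-HN A hn (∶⇒⊢ ⊢t) ⊢σ hσ)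
  where
    ⊢σ : WellTyped tyOf (lookupσ σ)
    ⊢σ y with σ y in eq
    ... | just u  = ∶⇒⊢ (respects y u eq)
    ... | nothing = ⊢var y
    hσ : RenamesOrHNAt A tyOf (lookupσ σ)
    hσ y with σ y in eq
    ... | just u  = inj₂ (domain y u eq , image y u eq)
    ... | nothing = inj₁ (y , refl)
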